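{- Let $H$ be a bipartite graph with parts $A,B$, $|A|=|B|=8$, whose vertices are $a_1,\dots,a_8\in A$ and $b_1,\dots,b_8\in B$ with $d(a_i)\le d(a_{i+1})$ and $d(b_i)\le d(b_{i+1})$ for all $i\in[7]$. (1) Suppose $d(a_1)\ge 1$, $d(a_2)\ge 2$, $d(a_3)\ge 3$, $d(a_4)\ge 3$, $d(a_i)\ge 4$ for all $i\in\{5,6,7,8\}$, and $d(b_1)\ge 1$, $d(b_2)\ge 2$, $d(b_3)\ge 3$, $d(b_4)\ge 3$, $d(b_j)\ge 4$ for all $j\in\{5,6,7,8\}$. Then $H$ has a 1-factor unless $|N(\{a_1,\dots,a_4\})|=3$ or $|N(\{b_1,\dots,b_4\})|=3$. (2) In particular, $H$ has a 1-factor if $d(a_i)\ge i$ and $d(b_i)\ge i$ for all $i\in[4]$ and $d(a_i)\ge 4$ and $d(b_i)\ge 4$ for all $i\in\{5,\dots,8\}$.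
   Context: $d(v)$ is the degree of $v$ in $H$ and $N(X)$ is the set of vertices adjacent to some vertex of $X$. -}

module Defs where

open import Data.Nat using (ℕ; _≤_; _<_)
open import Data.Bool using (Bool; true; false; _∨_)
open import Data.Fin using (Fin; toℕ)
open import Data.List using (List; filter; length)
open import Data.Bool.ListAction using (any)
open import Data.Fin.Base using ()
open import Data.List using (allFin)
open import Data.Bool using (T)
open import Relation.Binary.PropositionalEquality using (_≡_)
open import Function.Definitions using (Injective)
open import Data.Bool.Properties using (T?)

-- A bipartite graph H with parts A = {a_0..a_7} and B = {b_0..b_7}
-- (0-indexed: a_{i+1} in the paper is index i here), given by its
-- biadjacency relation: adj i j = true iff a_i b_j is an edge.
BipGraph : Set
BipGraph = Fin 8 → Fin 8 → Bool

transposeG : BipGraph → BipGraph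
transposeG H j i = H i j

degA : BipGraph → Fin 8 → ℕ
degA H i = length (filter (λ j → T? (H i j)) (allFin 8))

degB : BipGraph → Fin 8 → ℕ
degB H j = degA (transposeG H) j

nbrLowA : BipGraph → ℕ
nbrLowA H = length (filter (λ j → T? (any (λ i → H i j) (Data.List.take 4 (allFin 8)))) (allFin 8))
  where import Data.List

nbrLowB : BipGraph → ℕ
nbrLowB H = nbrLowA (transposeG H)

-- A 1-factor (perfect matching): each a_i matched to a distinct b_{m i}
-- along an edge. Since |A| = |B| = 8, an injective matching covers B too.
record OneFactor (H : BipGraph) : Set where
  field
    match     : Fin 8 → Fin 8
    injective : Injective _≡_ _≡_ match
    edges     : ∀ i → T (H i (match i))

Sorted : BipGraph → Set
Sorted H = (∀ (i j : Fin 8) → toℕ i ≤ toℕ j → degA H i ≤ degA H j)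
         × (∀ (i j : Fin 8) → toℕ i ≤ toℕ j → degB H i ≤ degB H j)
  where open import Data.Product using (_×_)

{-# OPTIONS --safe #-}
module Submission where

-- By Hall's theorem it suffices to show |N(S)| ≥ |S| for every S ⊆ A.  A deficient
-- set S with |N(S)| = t ≤ 3 consists of vertices of degree at most t; the degree
-- bounds allow at most t such vertices for t ≤ 2, and for t = 3 force S = {a₁,…,a₄}
-- with |N(S)| = 3, which is excluded.  So a deficient S has |N(S)| ≥ 4 and |S| ≥ 5.
-- Then U = B ∖ N(S) is deficient in the transposed graph, since N(U) ⊆ A ∖ S, yet
-- |N(U)| ≤ 8 − |S| ≤ 3, contradicting the same argument on the B side.
-- Hall's theorem is proved by the Halmos–Vaughan induction on |X|: if some nonempty
-- S ⊊ X is critical (|N(S)| = |S|), match S, and match X ∖ S into B ∖ N(S); otherwise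
-- every such S has |N(S)| > |S|, so any edge ab can be used and Hall's condition
-- survives the removal of a and b.

open import Defs
open import Data.Bool using (Bool; true; false; T)
open import Data.Bool.ListAction using (any)
open import Data.Bool.Properties using (T-≡)
open import Data.Empty using (⊥-elim)
open import Data.Fin using (Fin; zero; suc; toℕ; #_)
open import Data.Fin.Properties using (any?)
open import Data.Fin.Subset
  using (Subset; inside; outside; ⊤; _∈_; _∉_; _⊆_; _∪_; _∩_; _─_; _-_; ∁; ⁅_⁆; ∣_∣; Nonempty; Empty)
open import Data.Fin.Subset.Properties
  using ( _∈?_; _⊆?_; nonempty?; anySubset?; Empty-unique; ∣⊥∣≡0; ∣p∣≤n; ∈⊤; x∈⁅x⁆; x∈⁅y⁆⇒x≡y
        ; ∣⁅x⁆∣≡1; ⊆-trans; p⊆q⇒∣p∣≤∣q∣; p⊂q⇒∣p∣<∣q∣; x∈∁p⇒x∉p; x∉p⇒x∈∁p; ∣∁p∣≡n∸∣p∣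
        ; x∈p∩q⁺; x∈p∩q⁻; x∈p∪q⁺; x∈p∪q⁻; x∈p∧x∉q⇒x∈p─q; p─q⊆p; p∩q≢∅⇒∣p─q∣<∣p∣
        ; x∈p⇒∣p-x∣<∣p∣ )
open import Data.List using (filter; length; allFin)
import Data.List as List
open import Data.Nat using (ℕ; zero; suc; _+_; _∸_; _≤_; _<_; _≤ᵇ_; z≤n; s≤s; _≤?_)
open import Data.Nat.Properties
  using ( ≤-refl; ≤-reflexive; ≤-trans; ≤-antisym; <-≤-trans; ≤-<-trans; ≤-pred; ≤⇒≯; ≮⇒≥
        ; ≰⇒>; ≤⇒≤ᵇ; n≤1+n; +-suc; +-comm; m≤m+n; +-monoʳ-≤; +-cancelʳ-≤; ∸-monoʳ-≤; ∸-monoʳ-<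
        ; module ≤-Reasoning )
open import Data.Product using (∃; _×_; _,_; proj₁; proj₂)
open import Data.Sum using (_⊎_; inj₁; inj₂)
open import Data.Vec using ([]; _∷_; here; there; tabulate)
open import Data.Vec.Properties using (lookup∘tabulate; []=⇒lookup; lookup⇒[]=)
open import Function using (_∘_; id; flip; Equivalence)
open import Relation.Binary.PropositionalEquality
  using (_≡_; refl; sym; trans; cong; subst; module ≡-Reasoning)
open import Relation.Nullary using (¬_; Dec; _because_; yes; no; does; contradiction; _×-dec_; ¬?)
open import Relation.Nullary.Decidable using (T?; dec-true)
open import Relation.Nullary.Reflects using (invert)

private
  variable
    m n : ℕ

T-does⁺ : ∀ {p} {P : Set p} (P? : Dec P) → P → T (does P?)
T-does⁺ P? p = Equivalence.from T-≡ (dec-true P? p)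

T-does⁻ : ∀ {p} {P : Set p} (P? : Dec P) → T (does P?) → P
T-does⁻ (true because [p]) _ = invert [p]

∈-tabulate⁺ : {f : Fin n → Bool} {x : Fin n} → T (f x) → x ∈ tabulate f
∈-tabulate⁺ {f = f} {x} fx = lookup⇒[]= x _ (trans (lookup∘tabulate f x) (Equivalence.to T-≡ fx))

∈-tabulate⁻ : {f : Fin n → Bool} {x : Fin n} → x ∈ tabulate f → T (f x)
∈-tabulate⁻ {f = f} {x} x∈ =
  Equivalence.from T-≡ (trans (sym (lookup∘tabulate f x)) ([]=⇒lookup x∈))

length-filter-tabulate : ∀ {a} {A : Set a} (p : A → Bool) (g : Fin n → A) →
                         length (filter (T? ∘ p) (List.tabulate g)) ≡ ∣ tabulate (p ∘ g) ∣
length-filter-tabulate {n = zero}  p g = refl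
length-filter-tabulate {n = suc n} p g with p (g zero)
... | true  = cong suc (length-filter-tabulate p (g ∘ suc))
... | false = length-filter-tabulate p (g ∘ suc)

Empty⇒∣p∣≡0 : {p : Subset n} → Empty p → ∣ p ∣ ≡ 0
Empty⇒∣p∣≡0 {n} empty = trans (cong ∣_∣ (Empty-unique empty)) (∣⊥∣≡0 n)

0<∣p∣⇒Nonempty : {p : Subset n} → 0 < ∣ p ∣ → Nonempty p
0<∣p∣⇒Nonempty {p = p} 0<∣p∣ with nonempty? p
... | yes ne   = ne
... | no empty = contradiction (Empty⇒∣p∣≡0 empty) (λ ∣p∣≡0 → ≤⇒≯ (≤-reflexive ∣p∣≡0) 0<∣p∣)

∣p∪q∣+∣p∩q∣≡∣p∣+∣q∣ : (p q : Subset n) → ∣ p ∪ q ∣ + ∣ p ∩ q ∣ ≡ ∣ p ∣ + ∣ q ∣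
∣p∪q∣+∣p∩q∣≡∣p∣+∣q∣ []            []            = refl
∣p∪q∣+∣p∩q∣≡∣p∣+∣q∣ (outside ∷ p) (outside ∷ q) = ∣p∪q∣+∣p∩q∣≡∣p∣+∣q∣ p q
∣p∪q∣+∣p∩q∣≡∣p∣+∣q∣ (inside  ∷ p) (outside ∷ q) = cong suc (∣p∪q∣+∣p∩q∣≡∣p∣+∣q∣ p q)
∣p∪q∣+∣p∩q∣≡∣p∣+∣q∣ (outside ∷ p) (inside  ∷ q) =
  trans (cong suc (∣p∪q∣+∣p∩q∣≡∣p∣+∣q∣ p q)) (sym (+-suc ∣ p ∣ _))
∣p∪q∣+∣p∩q∣≡∣p∣+∣q∣ (inside  ∷ p) (inside  ∷ q) = cong suc (begin
  ∣ p ∪ q ∣ + suc ∣ p ∩ q ∣ ≡⟨ +-suc ∣ p ∪ q ∣ _ ⟩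
  suc (∣ p ∪ q ∣ + ∣ p ∩ q ∣) ≡⟨ cong suc (∣p∪q∣+∣p∩q∣≡∣p∣+∣q∣ p q) ⟩
  suc (∣ p ∣ + ∣ q ∣)       ≡⟨ sym (+-suc ∣ p ∣ _) ⟩
  ∣ p ∣ + suc ∣ q ∣         ∎)
  where open ≡-Reasoning

∣p∪q∣≤∣p∣+∣q∣ : (p q : Subset n) → ∣ p ∪ q ∣ ≤ ∣ p ∣ + ∣ q ∣
∣p∪q∣≤∣p∣+∣q∣ p q = ≤-trans (m≤m+n ∣ p ∪ q ∣ _) (≤-reflexive (∣p∪q∣+∣p∩q∣≡∣p∣+∣q∣ p q))

disjoint⇒∣p∣+∣q∣≡∣p∪q∣ : {p q : Subset n} → (∀ {x} → x ∈ p → x ∉ q) → ∣ p ∣ + ∣ q ∣ ≡ ∣ p ∪ q ∣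
disjoint⇒∣p∣+∣q∣≡∣p∪q∣ {p = p} {q} disjoint = begin
  ∣ p ∣ + ∣ q ∣             ≡⟨ sym (∣p∪q∣+∣p∩q∣≡∣p∣+∣q∣ p q) ⟩
  ∣ p ∪ q ∣ + ∣ p ∩ q ∣     ≡⟨ cong (∣ p ∪ q ∣ +_) (Empty⇒∣p∣≡0 p∩q-empty) ⟩
  ∣ p ∪ q ∣ + 0             ≡⟨ +-comm ∣ p ∪ q ∣ 0 ⟩
  ∣ p ∪ q ∣                 ∎
  where
  open ≡-Reasoning
  p∩q-empty : Empty (p ∩ q)
  p∩q-empty (x , x∈p∩q) = let (x∈p , x∈q) = x∈p∩q⁻ p q x∈p∩q in disjoint x∈p x∈q

x∈p─q⇒x∉q : {p q : Subset n} {x : Fin n} → x ∈ p ─ q → x ∉ q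
x∈p─q⇒x∉q {p = _ ∷ _} {inside ∷ _} ()         here
x∈p─q⇒x∉q {p = _ ∷ _} {_ ∷ _}      (there x∈) (there x∈q) = x∈p─q⇒x∉q x∈ x∈q

p⊆q∧∣q∣≤∣p∣⇒q⊆p : {p q : Subset n} → p ⊆ q → ∣ q ∣ ≤ ∣ p ∣ → q ⊆ p
p⊆q∧∣q∣≤∣p∣⇒q⊆p {p = p} p⊆q ∣q∣≤∣p∣ {x} x∈q with x ∈? p
... | yes x∈p = x∈p
... | no  x∉p = contradiction (p⊂q⇒∣p∣<∣q∣ (p⊆q , x , x∈q , x∉p)) (≤⇒≯ ∣q∣≤∣p∣)

-- N and _avoiding_ are opaque so that their arguments can be inferred from
-- membership goals, which would otherwise be unfolded into a tabulated vector.
opaque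
  N : (Fin m → Fin n → Bool) → Subset m → Subset n
  N E X = tabulate λ b → does (any? λ a → a ∈? X ×-dec T? (E a b))

  ∈N⁺ : {E : Fin m → Fin n → Bool} {X : Subset m} {a : Fin m} {b : Fin n} →
        a ∈ X → T (E a b) → b ∈ N E X
  ∈N⁺ {E = E} {X} {b = b} a∈X ab =
    ∈-tabulate⁺ (T-does⁺ (any? λ a → a ∈? X ×-dec T? (E a b)) (_ , a∈X , ab))

  ∈N⁻ : {E : Fin m → Fin n → Bool} {X : Subset m} {b : Fin n} →
        b ∈ N E X → ∃ λ a → a ∈ X × T (E a b)
  ∈N⁻ {E = E} {X} {b} b∈NX = T-does⁻ (any? λ a → a ∈? X ×-dec T? (E a b)) (∈-tabulate⁻ b∈NX)

N-mono : {E : Fin m → Fin n → Bool} {X Y : Subset m} → X ⊆ Y → N E X ⊆ N E Y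
N-mono X⊆Y b∈NX = let (a , a∈X , ab) = ∈N⁻ b∈NX in ∈N⁺ (X⊆Y a∈X) ab

deg : (Fin m → Fin n → Bool) → Fin m → ℕ
deg E a = ∣ tabulate (E a) ∣

deg≤∣N∣ : {E : Fin m → Fin n → Bool} {X : Subset m} {a : Fin m} → a ∈ X → deg E a ≤ ∣ N E X ∣
deg≤∣N∣ a∈X = p⊆q⇒∣p∣≤∣q∣ (λ b∈ → ∈N⁺ a∈X (∈-tabulate⁻ b∈))

opaque
  _avoiding_ : (Fin m → Fin n → Bool) → Subset n → Fin m → Fin n → Bool
  (E avoiding C) a b = does (T? (E a b) ×-dec ¬? (b ∈? C))

  avoiding⁺ : {E : Fin m → Fin n → Bool} {C : Subset n} {a : Fin m} {b : Fin n} →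
              T (E a b) → b ∉ C → T ((E avoiding C) a b)
  avoiding⁺ {E = E} {C} {a} {b} ab b∉C = T-does⁺ (T? (E a b) ×-dec ¬? (b ∈? C)) (ab , b∉C)

  avoiding⁻ : {E : Fin m → Fin n → Bool} {C : Subset n} {a : Fin m} {b : Fin n} →
              T ((E avoiding C) a b) → T (E a b) × b ∉ C
  avoiding⁻ {E = E} {C} {a} {b} = T-does⁻ (T? (E a b) ×-dec ¬? (b ∈? C))

N⊆N-avoiding∪ : {E : Fin m → Fin n → Bool} {X : Subset m} (C : Subset n) →
                N E X ⊆ N (E avoiding C) X ∪ C
N⊆N-avoiding∪ {X = X} C {b} b∈NX with ∈N⁻ b∈NX | b ∈? C
... | _ , _ , _    | yes b∈C = x∈p∪q⁺ (inj₂ b∈C)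
... | _ , a∈X , ab | no  b∉C = x∈p∪q⁺ (inj₁ (∈N⁺ a∈X (avoiding⁺ ab b∉C)))

N-flip-∁N⊆∁ : {E : Fin m → Fin n → Bool} {S : Subset m} → N (flip E) (∁ (N E S)) ⊆ ∁ S
N-flip-∁N⊆∁ a∈N with ∈N⁻ a∈N
... | b , b∈∁NS , ab = x∉p⇒x∈∁p (λ a∈S → x∈∁p⇒x∉p b∈∁NS (∈N⁺ a∈S ab))

Deficient : (Fin m → Fin n → Bool) → Subset m → Set
Deficient E S = ∣ N E S ∣ < ∣ S ∣

deficient-flip-∁N : {E : Fin n → Fin n → Bool} {S : Subset n} →
                    Deficient E S → Deficient (flip E) (∁ (N E S))
deficient-flip-∁N {n} {E} {S} deficient = begin-strict
  ∣ N (flip E) (∁ (N E S)) ∣ ≤⟨ p⊆q⇒∣p∣≤∣q∣ N-flip-∁N⊆∁ ⟩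
  ∣ ∁ S ∣                    ≡⟨ ∣∁p∣≡n∸∣p∣ S ⟩
  n ∸ ∣ S ∣                  <⟨ ∸-monoʳ-< deficient (∣p∣≤n S) ⟩
  n ∸ ∣ N E S ∣              ≡⟨ sym (∣∁p∣≡n∸∣p∣ (N E S)) ⟩
  ∣ ∁ (N E S) ∣              ∎
  where open ≤-Reasoning

HallCondition : (Fin m → Fin n → Bool) → Subset m → Set
HallCondition E X = ∀ S → S ⊆ X → ∣ S ∣ ≤ ∣ N E S ∣

record Matching (E : Fin m → Fin n → Bool) (X : Subset m) : Set where
  field
    match     : ∀ {a} → a ∈ X → Fin n
    edge      : ∀ {a} (a∈X : a ∈ X) → T (E a (match a∈X))
    injective : ∀ {a a′} (a∈X : a ∈ X) (a′∈X : a′ ∈ X) → match a∈X ≡ match a′∈X → a ≡ a′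

emptyMatching : {E : Fin m → Fin n → Bool} {X : Subset m} → Empty X → Matching E X
emptyMatching empty = record
  { match     = λ a∈X → ⊥-elim (empty (_ , a∈X))
  ; edge      = λ a∈X → ⊥-elim (empty (_ , a∈X))
  ; injective = λ a∈X _ _ → ⊥-elim (empty (_ , a∈X))
  }

edgeMatching : {E : Fin m → Fin n → Bool} {a : Fin m} {b : Fin n} → T (E a b) → Matching E ⁅ a ⁆
edgeMatching {E = E} {a} {b} ab = record
  { match     = λ _ → b
  ; edge      = λ a′∈⁅a⁆ → subst (λ a′ → T (E a′ b)) (sym (x∈⁅y⁆⇒x≡y a a′∈⁅a⁆)) ab
  ; injective = λ a′∈⁅a⁆ a″∈⁅a⁆ _ → trans (x∈⁅y⁆⇒x≡y a a′∈⁅a⁆) (sym (x∈⁅y⁆⇒x≡y a a″∈⁅a⁆))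
  }

module _ {E : Fin m → Fin n → Bool} {X S : Subset m} {C : Subset n}
         (M₁ : Matching E S) (M₁⊆C : ∀ {a} (a∈S : a ∈ S) → Matching.match M₁ a∈S ∈ C)
         (M₂ : Matching (E avoiding C) (X ─ S)) where
  private
    module M₁ = Matching M₁
    module M₂ = Matching M₂

    choose : ∀ {a} → a ∈ X → Dec (a ∈ S) → Fin n
    choose a∈X (yes a∈S) = M₁.match a∈S
    choose a∈X (no  a∉S) = M₂.match (x∈p∧x∉q⇒x∈p─q a∈X a∉S)

    choose-edge : ∀ {a} (a∈X : a ∈ X) (a∈?S : Dec (a ∈ S)) → T (E a (choose a∈X a∈?S))
    choose-edge a∈X (yes a∈S) = M₁.edge a∈S
    choose-edge a∈X (no  a∉S) = proj₁ (avoiding⁻ (M₂.edge _))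

    M₂∉C : ∀ {a} (a∈X─S : a ∈ X ─ S) → M₂.match a∈X─S ∉ C
    M₂∉C a∈X─S = proj₂ (avoiding⁻ (M₂.edge a∈X─S))

    choose-injective : ∀ {a a′} (a∈X : a ∈ X) (a′∈X : a′ ∈ X)
                       (a∈?S : Dec (a ∈ S)) (a′∈?S : Dec (a′ ∈ S)) →
                       choose a∈X a∈?S ≡ choose a′∈X a′∈?S → a ≡ a′
    choose-injective _ _ (yes a∈S) (yes a′∈S) eq = M₁.injective a∈S a′∈S eq
    choose-injective _ _ (no  _)   (no  _)    eq = M₂.injective _ _ eq
    choose-injective _ _ (yes a∈S) (no  _)    eq =
      contradiction (subst (_∈ C) eq (M₁⊆C a∈S)) (M₂∉C _)
    choose-injective _ _ (no  _)   (yes a′∈S) eq =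
      contradiction (subst (_∈ C) (sym eq) (M₁⊆C a′∈S)) (M₂∉C _)

  combineMatchings : Matching E X
  combineMatchings = record
    { match     = λ a∈X → choose a∈X (_ ∈? S)
    ; edge      = λ a∈X → choose-edge a∈X (_ ∈? S)
    ; injective = λ a∈X a′∈X → choose-injective a∈X a′∈X (_ ∈? S) (_ ∈? S)
    }

Critical : (Fin m → Fin n → Bool) → Subset m → Subset m → Set
Critical E X S = S ⊆ X × Nonempty S × ∣ S ∣ < ∣ X ∣ × ∣ N E S ∣ ≤ ∣ S ∣

critical? : (E : Fin m → Fin n → Bool) (X S : Subset m) → Dec (Critical E X S)
critical? E X S = S ⊆? X ×-dec nonempty? S ×-dec suc ∣ S ∣ ≤? ∣ X ∣ ×-dec ∣ N E S ∣ ≤? ∣ S ∣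

hallCondition-removeCritical : {E : Fin m → Fin n → Bool} {X S : Subset m} →
                               HallCondition E X → S ⊆ X → ∣ N E S ∣ ≤ ∣ S ∣ →
                               HallCondition (E avoiding N E S) (X ─ S)
hallCondition-removeCritical {m} {n} {E} {X} {S} hallX S⊆X ∣NS∣≤∣S∣ R R⊆X─S =
  +-cancelʳ-≤ ∣ S ∣ _ _ (begin
    ∣ R ∣ + ∣ S ∣           ≡⟨ disjoint⇒∣p∣+∣q∣≡∣p∪q∣ (λ x∈R → x∈p─q⇒x∉q (R⊆X─S x∈R)) ⟩
    ∣ R ∪ S ∣               ≤⟨ hallX (R ∪ S) R∪S⊆X ⟩
    ∣ N E (R ∪ S) ∣         ≤⟨ p⊆q⇒∣p∣≤∣q∣ N[R∪S]⊆ ⟩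
    ∣ N E′ R ∪ N E S ∣      ≤⟨ ∣p∪q∣≤∣p∣+∣q∣ (N E′ R) (N E S) ⟩
    ∣ N E′ R ∣ + ∣ N E S ∣  ≤⟨ +-monoʳ-≤ ∣ N E′ R ∣ ∣NS∣≤∣S∣ ⟩
    ∣ N E′ R ∣ + ∣ S ∣      ∎)
  where
  open ≤-Reasoning
  E′ : Fin m → Fin n → Bool
  E′ = E avoiding N E S
  R∪S⊆X : R ∪ S ⊆ X
  R∪S⊆X x∈R∪S with x∈p∪q⁻ R S x∈R∪S
  ... | inj₁ x∈R = p─q⊆p X S (R⊆X─S x∈R)
  ... | inj₂ x∈S = S⊆X x∈S
  N[R∪S]⊆ : N E (R ∪ S) ⊆ N E′ R ∪ N E S
  N[R∪S]⊆ b∈N with ∈N⁻ b∈N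
  ... | a , a∈R∪S , ab with x∈p∪q⁻ R S a∈R∪S
  ...   | inj₁ a∈R = N⊆N-avoiding∪ (N E S) (∈N⁺ a∈R ab)
  ...   | inj₂ a∈S = x∈p∪q⁺ (inj₂ (∈N⁺ a∈S ab))

hallCondition-removeEdge : {E : Fin m → Fin n → Bool} {X : Subset m} {a : Fin m} (b : Fin n) →
                           HallCondition E X → (∀ S → ¬ Critical E X S) → a ∈ X →
                           HallCondition (E avoiding ⁅ b ⁆) (X - a)
hallCondition-removeEdge {m} {n} {E} {X} {a} b hallX no-critical a∈X R R⊆X-a with nonempty? R
... | no  empty = ≤-trans (≤-reflexive (Empty⇒∣p∣≡0 empty)) z≤n
... | yes nonempty = +-cancelʳ-≤ 1 _ _ (begin
    ∣ R ∣ + 1             ≡⟨ +-comm ∣ R ∣ 1 ⟩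
    suc ∣ R ∣             ≤⟨ expanding ⟩
    ∣ N E R ∣             ≤⟨ p⊆q⇒∣p∣≤∣q∣ (N⊆N-avoiding∪ ⁅ b ⁆) ⟩
    ∣ N E′ R ∪ ⁅ b ⁆ ∣    ≤⟨ ∣p∪q∣≤∣p∣+∣q∣ (N E′ R) ⁅ b ⁆ ⟩
    ∣ N E′ R ∣ + ∣ ⁅ b ⁆ ∣ ≡⟨ cong (∣ N E′ R ∣ +_) (∣⁅x⁆∣≡1 b) ⟩
    ∣ N E′ R ∣ + 1         ∎)
  where
  open ≤-Reasoning
  E′ : Fin m → Fin n → Bool
  E′ = E avoiding ⁅ b ⁆
  R⊆X : R ⊆ X
  R⊆X x∈R = p─q⊆p X ⁅ a ⁆ (R⊆X-a x∈R)
  expanding : ∣ R ∣ < ∣ N E R ∣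
  expanding = ≰⇒> λ ∣NR∣≤∣R∣ →
    no-critical R (R⊆X , nonempty , ≤-<-trans (p⊆q⇒∣p∣≤∣q∣ R⊆X-a) (x∈p⇒∣p-x∣<∣p∣ a∈X) , ∣NR∣≤∣R∣)

neighbour : {E : Fin m → Fin n → Bool} {X : Subset m} {a : Fin m} →
            HallCondition E X → a ∈ X → ∃ λ b → T (E a b)
neighbour {E = E} {X} {a} hallX a∈X with 0<∣p∣⇒Nonempty 0<∣N⁅a⁆∣
  where
  0<∣N⁅a⁆∣ : 0 < ∣ N E ⁅ a ⁆ ∣
  0<∣N⁅a⁆∣ = subst (_≤ ∣ N E ⁅ a ⁆ ∣) (∣⁅x⁆∣≡1 a)
               (hallX ⁅ a ⁆ (λ x∈⁅a⁆ → subst (_∈ X) (sym (x∈⁅y⁆⇒x≡y a x∈⁅a⁆)) a∈X))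
... | b , b∈N⁅a⁆ with ∈N⁻ b∈N⁅a⁆
...   | a′ , a′∈⁅a⁆ , a′b = b , subst (λ x → T (E x b)) (x∈⁅y⁆⇒x≡y a a′∈⁅a⁆) a′b

HallUpTo : ℕ → ℕ → ℕ → Set
HallUpTo m n k = ∀ {E : Fin m → Fin n → Bool} {X} → ∣ X ∣ ≤ k → HallCondition E X → Matching E X

module HallStep {k} (hall-k : HallUpTo m n k) {E : Fin m → Fin n → Bool} {X : Subset m}
                (∣X∣≤1+k : ∣ X ∣ ≤ suc k) (hallX : HallCondition E X) where

  private
    smaller : ∀ {j} → j < ∣ X ∣ → j ≤ k
    smaller j<∣X∣ = ≤-pred (<-≤-trans j<∣X∣ ∣X∣≤1+k)

  splitAtCritical : {S : Subset m} → Critical E X S → Matching E X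
  splitAtCritical {S} (S⊆X , (a , a∈S) , ∣S∣<∣X∣ , ∣NS∣≤∣S∣) =
    combineMatchings M₁ (λ a∈S → ∈N⁺ a∈S (Matching.edge M₁ a∈S)) M₂
    where
    M₁ : Matching E S
    M₁ = hall-k (smaller ∣S∣<∣X∣) (λ R R⊆S → hallX R (⊆-trans R⊆S S⊆X))
    M₂ : Matching (E avoiding N E S) (X ─ S)
    M₂ = hall-k (smaller (p∩q≢∅⇒∣p─q∣<∣p∣ X S (a , x∈p∩q⁺ (S⊆X a∈S , a∈S))))
                (hallCondition-removeCritical hallX S⊆X ∣NS∣≤∣S∣)

  splitAtEdge : {a : Fin m} → a ∈ X → (∀ S → ¬ Critical E X S) → Matching E X
  splitAtEdge {a} a∈X no-critical with neighbour hallX a∈X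
  ... | b , ab = combineMatchings (edgeMatching ab) (λ _ → x∈⁅x⁆ b)
                   (hall-k (smaller (x∈p⇒∣p-x∣<∣p∣ a∈X))
                           (hallCondition-removeEdge b hallX no-critical a∈X))

  matching : Matching E X
  matching with nonempty? X
  ... | no  empty = emptyMatching empty
  ... | yes (a , a∈X) with anySubset? (critical? E X)
  ...   | yes (S , critical) = splitAtCritical critical
  ...   | no  no-critical    = splitAtEdge a∈X (λ S critical → no-critical (S , critical))

hall-≤ : ∀ k → HallUpTo m n k
hall-≤ zero    ∣X∣≤0 _ = emptyMatching λ (a , a∈X) →
  contradiction (≤-trans (x∈p⇒∣p-x∣<∣p∣ a∈X) ∣X∣≤0) λ ()
hall-≤ (suc k) ∣X∣≤1+k hallX = HallStep.matching (hall-≤ k) ∣X∣≤1+k hallX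

hall : {E : Fin m → Fin n → Bool} {X : Subset m} → HallCondition E X → Matching E X
hall {X = X} = hall-≤ _ (∣p∣≤n X)

degreeBound : Fin 8 → ℕ
degreeBound zero                      = 1
degreeBound (suc zero)                = 2
degreeBound (suc (suc zero))          = 3
degreeBound (suc (suc (suc zero)))    = 3
degreeBound (suc (suc (suc (suc _)))) = 4

boundAtMost : ℕ → Subset 8
boundAtMost t = tabulate λ a → degreeBound a ≤ᵇ t

∈boundAtMost : ∀ {a t} → degreeBound a ≤ t → a ∈ boundAtMost t
∈boundAtMost {t = t} bound≤t = ∈-tabulate⁺ {f = λ a → degreeBound a ≤ᵇ t} (≤⇒≤ᵇ bound≤t)

first4 : Subset 8
first4 = boundAtMost 3

t<∣boundAtMost∣⇒t≡3⊎4≤t : ∀ t → t < ∣ boundAtMost t ∣ → t ≡ 3 ⊎ 4 ≤ t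
t<∣boundAtMost∣⇒t≡3⊎4≤t 0 ()
t<∣boundAtMost∣⇒t≡3⊎4≤t 1 (s≤s ())
t<∣boundAtMost∣⇒t≡3⊎4≤t 2 (s≤s (s≤s ()))
t<∣boundAtMost∣⇒t≡3⊎4≤t 3 _ = inj₁ refl
t<∣boundAtMost∣⇒t≡3⊎4≤t (suc (suc (suc (suc t)))) _ = inj₂ (s≤s (s≤s (s≤s (s≤s z≤n))))

record DegreeCondition (E : Fin 8 → Fin 8 → Bool) : Set where
  field
    degreeBound≤deg : ∀ a → degreeBound a ≤ deg E a
    ∣N[first4]∣≢3   : ¬ ∣ N E first4 ∣ ≡ 3

module _ {E : Fin 8 → Fin 8 → Bool} (condition : DegreeCondition E) where
  open DegreeCondition condition

  ⊆boundAtMost∣N∣ : {S : Subset 8} → S ⊆ boundAtMost ∣ N E S ∣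
  ⊆boundAtMost∣N∣ {x = a} a∈S = ∈boundAtMost (≤-trans (degreeBound≤deg a) (deg≤∣N∣ a∈S))

  deficient⇒4≤∣N∣ : {S : Subset 8} → Deficient E S → 4 ≤ ∣ N E S ∣
  deficient⇒4≤∣N∣ {S} deficient
    with t<∣boundAtMost∣⇒t≡3⊎4≤t ∣ N E S ∣ (<-≤-trans deficient (p⊆q⇒∣p∣≤∣q∣ ⊆boundAtMost∣N∣))
  ... | inj₂ 4≤∣NS∣ = 4≤∣NS∣
  ... | inj₁ ∣NS∣≡3 = contradiction (≤-antisym ∣N[first4]∣≤3 3≤∣N[first4]∣) ∣N[first4]∣≢3
    where
    first4⊆S : first4 ⊆ S
    first4⊆S = p⊆q∧∣q∣≤∣p∣⇒q⊆p (subst (λ t → S ⊆ boundAtMost t) ∣NS∣≡3 ⊆boundAtMost∣N∣)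
                                 (subst (_< ∣ S ∣) ∣NS∣≡3 deficient)
    ∣N[first4]∣≤3 : ∣ N E first4 ∣ ≤ 3
    ∣N[first4]∣≤3 = ≤-trans (p⊆q⇒∣p∣≤∣q∣ (N-mono first4⊆S)) (≤-reflexive ∣NS∣≡3)
    3≤∣N[first4]∣ : 3 ≤ ∣ N E first4 ∣
    3≤∣N[first4]∣ = ≤-trans (degreeBound≤deg (# 2)) (deg≤∣N∣ (∈boundAtMost ≤-refl))

hallCondition : {E : Fin 8 → Fin 8 → Bool} → DegreeCondition E → DegreeCondition (flip E) →
                (S : Subset 8) → ∣ S ∣ ≤ ∣ N E S ∣
hallCondition {E} conditionA conditionB S = ≮⇒≥ λ deficient →
  let 5≤∣S∣ : 5 ≤ ∣ S ∣
      5≤∣S∣ = ≤-<-trans (deficient⇒4≤∣N∣ conditionA deficient) deficient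
      ∣N∁N∣≤3 : ∣ N (flip E) (∁ (N E S)) ∣ ≤ 3
      ∣N∁N∣≤3 = begin
        ∣ N (flip E) (∁ (N E S)) ∣ ≤⟨ p⊆q⇒∣p∣≤∣q∣ N-flip-∁N⊆∁ ⟩
        ∣ ∁ S ∣                    ≡⟨ ∣∁p∣≡n∸∣p∣ S ⟩
        8 ∸ ∣ S ∣                  ≤⟨ ∸-monoʳ-≤ 8 5≤∣S∣ ⟩
        3                          ∎
  in ≤⇒≯ ∣N∁N∣≤3 (deficient⇒4≤∣N∣ conditionB (deficient-flip-∁N deficient))
  where open ≤-Reasoning

oneFactor : {H : BipGraph} → DegreeCondition H → DegreeCondition (transposeG H) → OneFactor H
oneFactor {H} conditionA conditionB = record
  { match     = λ a → match (∈⊤ {x = a})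
  ; injective = injective ∈⊤ ∈⊤
  ; edges     = λ a → edge (∈⊤ {x = a})
  }
  where
  open Matching (hall {E = H} {X = ⊤} (λ S _ → hallCondition conditionA conditionB S))

degA≡deg : (H : BipGraph) (a : Fin 8) → degA H a ≡ deg H a
degA≡deg H a = length-filter-tabulate (H a) id

-- Unfolded, N H first4 computes to the same disjunction H a₁ b ∨ … ∨ H a₄ b as nbrLowA.
opaque
  unfolding N

  nbrLowA≡∣N[first4]∣ : (H : BipGraph) → nbrLowA H ≡ ∣ N H first4 ∣
  nbrLowA≡∣N[first4]∣ H = length-filter-tabulate (λ j → any (λ i → H i j) (List.take 4 (allFin 8))) id

degreeBound≤ : {d : Fin 8 → ℕ} → 1 ≤ d (# 0) → 2 ≤ d (# 1) → 3 ≤ d (# 2) → 3 ≤ d (# 3) →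
               (∀ i → 4 ≤ toℕ i → 4 ≤ d i) → ∀ a → degreeBound a ≤ d a
degreeBound≤ d₀ _  _  _  _   zero                          = d₀
degreeBound≤ _  d₁ _  _  _   (suc zero)                    = d₁
degreeBound≤ _  _  d₂ _  _   (suc (suc zero))              = d₂
degreeBound≤ _  _  _  d₃ _   (suc (suc (suc zero)))        = d₃
degreeBound≤ _  _  _  _  d₄₊ a@(suc (suc (suc (suc _)))) = d₄₊ a (s≤s (s≤s (s≤s (s≤s z≤n))))

degreeCondition : (H : BipGraph) → (∀ a → degreeBound a ≤ degA H a) → ¬ nbrLowA H ≡ 3 →
                  DegreeCondition H
degreeCondition H bounds nbrLowA≢3 = record
  { degreeBound≤deg = λ a → subst (degreeBound a ≤_) (degA≡deg H a) (bounds a)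
  ; ∣N[first4]∣≢3   = nbrLowA≢3 ∘ trans (nbrLowA≡∣N[first4]∣ H)
  }

degreeCondition-strong : (H : BipGraph) → (∀ i → toℕ i ≤ 3 → suc (toℕ i) ≤ degA H i) →
                         (∀ i → 4 ≤ toℕ i → 4 ≤ degA H i) → DegreeCondition H
degreeCondition-strong H low high = degreeCondition H
  (degreeBound≤ (low (# 0) z≤n) (low (# 1) (s≤s z≤n)) (low (# 2) (s≤s (s≤s z≤n)))
                (≤-trans (n≤1+n 3) 4≤d₃) high)
  (λ nbrLowA≡3 → ≤⇒≯ (≤-reflexive nbrLowA≡3) 3<nbrLowA)
  where
  4≤d₃ : 4 ≤ degA H (# 3)
  4≤d₃ = low (# 3) (s≤s (s≤s (s≤s z≤n)))
  3<nbrLowA : 3 < nbrLowA H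
  3<nbrLowA = begin-strict
    3                 <⟨ 4≤d₃ ⟩
    degA H (# 3)      ≡⟨ degA≡deg H (# 3) ⟩
    deg H (# 3)       ≤⟨ deg≤∣N∣ (∈boundAtMost ≤-refl) ⟩
    ∣ N H first4 ∣    ≡⟨ sym (nbrLowA≡∣N[first4]∣ H) ⟩
    nbrLowA H         ∎
    where open ≤-Reasoning

corollary21 : (H : BipGraph) → Sorted H →
    -- part (1)
    ((1 ≤ degA H (# 0)) → (2 ≤ degA H (# 1)) → (3 ≤ degA H (# 2)) → (3 ≤ degA H (# 3)) →
     (∀ (i : Fin 8) → 4 ≤ toℕ i → 4 ≤ degA H i) →
     (1 ≤ degB H (# 0)) → (2 ≤ degB H (# 1)) → (3 ≤ degB H (# 2)) → (3 ≤ degB H (# 3)) →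
     (∀ (j : Fin 8) → 4 ≤ toℕ j → 4 ≤ degB H j) →
     ¬ (nbrLowA H ≡ 3) → ¬ (nbrLowB H ≡ 3) → OneFactor H)
    ×
    -- part (2)
    ((∀ (i : Fin 8) → toℕ i ≤ 3 → suc (toℕ i) ≤ degA H i) →
     (∀ (i : Fin 8) → toℕ i ≤ 3 → suc (toℕ i) ≤ degB H i) →
     (∀ (i : Fin 8) → 4 ≤ toℕ i → 4 ≤ degA H i) →
     (∀ (i : Fin 8) → 4 ≤ toℕ i → 4 ≤ degB H i) →
     OneFactor H)
corollary21 H _ =
    (λ a₀ a₁ a₂ a₃ a₄₊ b₀ b₁ b₂ b₃ b₄₊ nbrLowA≢3 nbrLowB≢3 → oneFactor
       (degreeCondition H (degreeBound≤ a₀ a₁ a₂ a₃ a₄₊) nbrLowA≢3)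
       (degreeCondition (transposeG H) (degreeBound≤ b₀ b₁ b₂ b₃ b₄₊) nbrLowB≢3))
  , (λ lowA lowB highA highB → oneFactor
       (degreeCondition-strong H lowA highA)
       (degreeCondition-strong (transposeG H) lowB highB))
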